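{- Consider the algorithm PCAlg described in the context, run on input $U$, $k$, $\mathcal{S}=\{S_1,\dots,S_m\}$. Consider an iteration of its main loop corresponding to values $i,j,\ell$, and let $S_i=\{s_1,\dots,s_r\}$. Then the family $\mathcal{A}_{r,j}$ computed in this iteration represents the family $$\mathcal{A}^*_{i,j,\ell}=\Big\{S\cup S'_i : S\in\Big(\bigcup_{1\le j'\le j}\mathrm{M}[i-1,j',\ell-1]\Big)\cup\{\emptyset\},\ S'_i\subseteq S_i,\ |S\cup S'_i|=j\Big\},$$ where $\mathrm{M}[i-1,j',\ell-1]$ denotes the value of that matrix entry at the time of the iteration.
   Context: Representation: for a universe $U$, integer $k$, and a family $\mathcal{F}$ of $p$-subsets of $U$ ($p\le k$), a family $\widehat{\mathcal{F}}$ represents $\mathcal{F}$ if $\widehat{\mathcal{F}}\subseteq\mathcal{F}$ and for every $X\in\mathcal{F}$ and $Y\subseteq U\setminus X$ with $|Y|\le k-p$ there is $\widehat{X}\in\widehat{\mathcal{F}}$ with $\widehat{X}\cap Y=\emptyset$. RepAlg$(U,k,\mathcal{F})$ denotes a procedure that, given a family $\mathcal{F}$ of $p$-subsets of $U$, returns a family that represents $\mathcal{F}$. Algorithm PCAlg$(U,k,\mathcal{S}=\{S_1,\dots,S_m\})$: (1) if some $S\in\mathcal{S}$ has $|S|\ge k$, return 1. (2) Let M be a matrix with an entry $\mathrm{M}[i,j,\ell]$ for all $0\le i\le m$, $1\le j\le k$, $0\le \ell\le k$, each initialized to $\emptyset$. (3) For $i=1,\dots,m$, for $j=1,\dots,k$,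 for $\ell=1,\dots,\min\{i,k\}$ (nested loops in this order): let $S_i=\{s_1,\dots,s_r\}$; set $\mathcal{A}_{0,0}=\{\emptyset\}$ and $\mathcal{A}_{0,j'}=\mathrm{M}[i-1,j',\ell-1]$ for $j'=1,\dots,j$; then for $r'=1,\dots,r$ and $j'=0,\dots,j$ set $\mathcal{A}_{r',j'}=$ RepAlg$\big(U,k,\mathcal{A}_{r'-1,j'}\cup\{S\cup\{s_{r'}\}: j'\ge 1,\ S\in\mathcal{A}_{r'-1,j'-1},\ s_{r'}\notin S\}\big)$; finally set $\mathrm{M}[i,j,\ell]=$ RepAlg$(U,k,\mathrm{M}[i-1,j,\ell]\cup\mathcal{A}_{r,j})$. (4) Return the smallest $\ell$ such that $\mathrm{M}[m,k,\ell]\ne\emptyset$. -}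

module Defs where

open import Data.Nat using (ℕ; zero; suc; _≤_; _<_; _∸_; _⊓_)
open import Data.Nat.Properties using (_≤?_)
open import Data.Fin using (Fin)
open import Data.Fin.Subset using (Subset; ⁅_⁆; _∪_; _∩_; ∣_∣; _⊆_) renaming (⊥ to ∅)
open import Data.Fin.Subset.Properties using (_∈?_)
open import Data.List using (List; []; _∷_; _++_; length)
open import Data.List.Membership.Propositional renaming (_∈_ to _∈ˡ_)
open import Data.Product using (Σ; _×_; ∃; ∃-syntax)
open import Data.Sum using (_⊎_)
open import Relation.Binary.PropositionalEquality using (_≡_)
open import Relation.Nullary using (yes; no; Dec)
open import Relation.Nullary.Decidable using (_×-dec_)

-- The universe U is Fin n; subsets of U are Data.Fin.Subset.Subset n.
-- A (possibly infinite / abstract) family of subsets is a predicate.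
Family : ℕ → Set₁
Family n = Subset n → Set

⟦_⟧ : ∀ {n} → List (Subset n) → Family n
⟦ F ⟧ X = X ∈ˡ F

Uniform : ∀ {n} → ℕ → Family n → Set
Uniform p F = ∀ X → F X → ∣ X ∣ ≡ p

Represents : ∀ {n} → ℕ → ℕ → Family n → Family n → Set
Represents {n} k p Fhat F =
  (∀ X → Fhat X → F X) ×
  (∀ X → F X → ∀ (Y : Subset n) → X ∩ Y ≡ ∅ → ∣ Y ∣ ≤ k ∸ p →
     ∃[ Xh ] (Fhat Xh × Xh ∩ Y ≡ ∅))

RepAlgSpec : ∀ {n} → ℕ → (List (Subset n) → List (Subset n)) → Set
RepAlgSpec {n} k rep =
  ∀ p → p ≤ k → (F : List (Subset n)) → Uniform p ⟦ F ⟧ →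
    Represents k p ⟦ rep F ⟧ ⟦ F ⟧

toSubset : ∀ {n} → List (Fin n) → Subset n
toSubset []       = ∅
toSubset (s ∷ ss) = ⁅ s ⁆ ∪ toSubset ss

-- 1-indexed access S_i into the input list 𝒮 = (S_1,...,S_m) (default [])
nth : ∀ {A : Set} → List (List A) → ℕ → List A
nth []       _             = []
nth (x ∷ xs) zero          = []
nth (x ∷ xs) (suc zero)    = x
nth (x ∷ xs) (suc (suc i)) = nth xs (suc i)

extend : ∀ {n} → Fin n → List (Subset n) → List (Subset n)
extend s []      = []
extend s (S ∷ F) with s ∈? S
... | yes _ = extend s F
... | no  _ = (S ∪ ⁅ s ⁆) ∷ extend s F

module PCAlg {n : ℕ} (k : ℕ) (𝒮 : List (List (Fin n)))
             (rep : List (Subset n) → List (Subset n)) where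

  m : ℕ
  m = length 𝒮

  -- one step r'-1 ↦ r' of the inner table: given the column j' ↦ 𝒜_{r'-1,j'},
  -- produce j' ↦ 𝒜_{r',j'}
  step : Fin n → (ℕ → List (Subset n)) → (ℕ → List (Subset n))
  step s A zero     = rep (A zero)
  step s A (suc j') = rep (A (suc j') ++ extend s (A j'))

  steps : List (Fin n) → (ℕ → List (Subset n)) → (ℕ → List (Subset n))
  steps []       A = A
  steps (s ∷ ss) A = steps ss (step s A)

  inLoop : ℕ → ℕ → ℕ → Set
  inLoop i j ℓ = (1 ≤ j × j ≤ k) × (1 ≤ ℓ × ℓ ≤ i ⊓ k)

  inLoop? : ∀ i j ℓ → Dec (inLoop i j ℓ)
  inLoop? i j ℓ = ((1 ≤? j) ×-dec (j ≤? k)) ×-dec ((1 ≤? ℓ) ×-dec (ℓ ≤? i ⊓ k))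

  -- 𝒜_{0,j'} in an iteration with first index i and third index ℓ, where
  -- Mprev j' ℓ' is the entry M[i-1,j',ℓ']
  A₀ : (ℕ → ℕ → List (Subset n)) → ℕ → ℕ → List (Subset n)
  A₀ Mprev ℓ zero     = ∅ ∷ []
  A₀ Mprev ℓ (suc j') = Mprev (suc j') (ℓ ∸ 1)

  -- Row i is only written
  -- during the iterations with first index i and only reads row i-1,
  -- so M (i-1) is also the value of row i-1 at the time of any iteration
  -- with first index i.
  M : ℕ → ℕ → ℕ → List (Subset n)
  M zero    j ℓ = []
  M (suc i) j ℓ with inLoop? (suc i) j ℓ
  ... | yes _ = rep (M i j ℓ ++ steps (nth 𝒮 (suc i)) (A₀ (M i) ℓ) j)
  ... | no  _ = []

  -- A i ℓ j' = 𝒜_{r,j'} (r = |S_i|) as computed in the iteration (i, j, ℓ)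
  -- for any j ≥ j' (its value does not depend on j, which only bounds the
  -- range of computed columns).
  A : ℕ → ℕ → ℕ → List (Subset n)
  A i ℓ = steps (nth 𝒮 i) (A₀ (M (i ∸ 1)) ℓ)

  AStar : ℕ → ℕ → ℕ → Family n
  AStar i j ℓ X =
    ∃[ S ] ∃[ S' ]
      ((S ≡ ∅ ⊎ ∃[ j' ] ((1 ≤ j' × j' ≤ j) × S ∈ˡ M (i ∸ 1) j' (ℓ ∸ 1))) ×
       S' ⊆ toSubset (nth 𝒮 i) ×
       X ≡ S ∪ S' ×
       ∣ X ∣ ≡ j)

-- Write E(B, P, j) for the j-sets S ∪ S′ with S in a base family B and S′ ⊆ P.  In one
-- iteration the column j′ ↦ 𝒜_{r′,j′} represents j′ ↦ E(B, {s₁,…,s_{r′}}, j′), where B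
-- consists of ∅ and the members of the entries M[i-1,·,ℓ-1].  For s = s_{r′+1}, a member
-- of E(B, P ∪ {s}, j′+1) either lies in E(B, P, j′+1), or is Z ∪ {s} with Z ∈ E(B, P, j′)
-- and s ∉ Z.  The second kind is represented by extending 𝒜_{r′,j′} by s: if Y avoids
-- Z ∪ {s} and |Y| ≤ k-(j′+1), then |Y ∪ {s}| ≤ k-j′, so some Ẑ ∈ 𝒜_{r′,j′} avoids Y ∪ {s},
-- and Ẑ ∪ {s} avoids Y.  Representation is transitive, so RepAlg keeps the invariant.
module Submission where

open import Defs
open import Data.Nat using (ℕ; zero; suc; _≤_; _<_; _⊓_; _∸_; z≤n; s≤s)
open import Data.Nat.Properties using (≤-trans; ≤-reflexive; <⇒≤; +-∸-assoc; 0≢1+n)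
open import Data.Fin using (Fin; zero; suc)
open import Data.Fin.Subset
  using (Subset; inside; outside; _∈_; _∉_; _⊆_; _∪_; _∩_; _─_; _-_; ⁅_⁆; ∣_∣)
  renaming (⊥ to ∅)
open import Data.Fin.Subset.Properties
  using ( _∈?_; ∉⊥; ∣⊥∣≡0; x∈⁅x⁆; x∈⁅y⁆⇒x≡y; ⊆-refl; ⊆-antisym; p⊆q⇒∣p∣≤∣q∣
        ; x∈p∩q⁺; x∈p∩q⁻; x∈p∪q⁻; x∈p∪q⁺; p⊆p∪q; ∩-comm; ∪-identityˡ; ∪-identityʳ; ∪-assoc; ∪-comm
        ; x∈p∧x∉q⇒x∈p─q; p─q⊆p; p─q─r≡p─r─q; x∈p∧x≢y⇒x∈p-y )
open import Data.Vec.Base using (_∷_; here; there)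
open import Data.List using (List; []; _∷_; _++_; length)
open import Data.List.Relation.Unary.All using (All)
open import Data.List.Relation.Unary.Any using (here; there)
open import Data.List.Relation.Unary.Unique.Propositional using (Unique)
open import Data.List.Membership.Propositional using () renaming (_∈_ to _∈ˡ_)
open import Data.List.Membership.Propositional.Properties using (∈-++⁻; ∈-++⁺ˡ; ∈-++⁺ʳ)
open import Data.Product using (_×_; ∃-syntax; _,_; proj₁)
open import Data.Sum using (_⊎_; inj₁; inj₂; [_,_])
open import Data.Empty using (⊥-elim)
open import Function using (_∘_; id)
open import Relation.Binary.PropositionalEquality using (_≡_; refl; sym; trans; cong; subst)
open import Relation.Nullary using (yes; no)
open import Relation.Unary using (_≐_) renaming (_⊆_ to _⊆ᶠ_; _∪_ to _∪ᶠ_)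

x∉p⇒∣p∪⁅x⁆∣≡1+∣p∣ : ∀ {n} (p : Subset n) {x} → x ∉ p → ∣ p ∪ ⁅ x ⁆ ∣ ≡ suc ∣ p ∣
x∉p⇒∣p∪⁅x⁆∣≡1+∣p∣ (outside ∷ p) {zero}  x∉p = cong (suc ∘ ∣_∣) (∪-identityʳ p)
x∉p⇒∣p∪⁅x⁆∣≡1+∣p∣ (inside  ∷ p) {zero}  x∉p = ⊥-elim (x∉p here)
x∉p⇒∣p∪⁅x⁆∣≡1+∣p∣ (outside ∷ p) {suc x} x∉p = x∉p⇒∣p∪⁅x⁆∣≡1+∣p∣ p (x∉p ∘ there)
x∉p⇒∣p∪⁅x⁆∣≡1+∣p∣ (inside  ∷ p) {suc x} x∉p = cong suc (x∉p⇒∣p∪⁅x⁆∣≡1+∣p∣ p (x∉p ∘ there))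

x∈p─q⇒x∉q : ∀ {n} (p q : Subset n) {x} → x ∈ p ─ q → x ∉ q
x∈p─q⇒x∉q (_ ∷ p) (outside ∷ q) here      ()
x∈p─q⇒x∉q (_ ∷ p) (outside ∷ q) (there x) (there y) = x∈p─q⇒x∉q p q x y
x∈p─q⇒x∉q (_ ∷ p) (inside  ∷ q) (there x) (there y) = x∈p─q⇒x∉q p q x y

module _ {n : ℕ} where

  x∉p-x : ∀ (p : Subset n) x → x ∉ p - x
  x∉p-x p x x∈p-x = x∈p─q⇒x∉q p ⁅ x ⁆ x∈p-x (x∈⁅x⁆ x)

  q─p⊆r⇒q⊆p∪r : ∀ {p q r : Subset n} → q ─ p ⊆ r → q ⊆ p ∪ r
  q─p⊆r⇒q⊆p∪r {p} q─p⊆r {x} x∈q with x ∈? p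
  ... | yes x∈p = x∈p∪q⁺ (inj₁ x∈p)
  ... | no  x∉p = x∈p∪q⁺ (inj₂ (q─p⊆r (x∈p∧x∉q⇒x∈p─q x∈q x∉p)))

  p⊆q⇒q≡p∪[q─p] : ∀ {p q : Subset n} → p ⊆ q → q ≡ p ∪ (q ─ p)
  p⊆q⇒q≡p∪[q─p] {p} {q} p⊆q =
    ⊆-antisym (q─p⊆r⇒q⊆p∪r id) ([ p⊆q , p─q⊆p q p ] ∘ x∈p∪q⁻ p (q ─ p))

  p∪q─p⊆q : ∀ (p q : Subset n) → (p ∪ q) ─ p ⊆ q
  p∪q─p⊆q p q x∈ with x∈p∪q⁻ p q (p─q⊆p (p ∪ q) p x∈)
  ... | inj₁ x∈p = ⊥-elim (x∈p─q⇒x∉q (p ∪ q) p x∈ x∈p)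
  ... | inj₂ x∈q = x∈q

  x∈p⇒p≡[p-x]∪⁅x⁆ : ∀ {p : Subset n} {x} → x ∈ p → p ≡ (p - x) ∪ ⁅ x ⁆
  x∈p⇒p≡[p-x]∪⁅x⁆ {p} {x} x∈p = trans (p⊆q⇒q≡p∪[q─p] ⁅x⁆⊆p) (∪-comm ⁅ x ⁆ (p - x))
    where
    ⁅x⁆⊆p : ⁅ x ⁆ ⊆ p
    ⁅x⁆⊆p y∈⁅x⁆ = subst (_∈ p) (sym (x∈⁅y⁆⇒x≡y x y∈⁅x⁆)) x∈p

  q⊆p∪⁅x⁆⇒x∉q⇒q⊆p : ∀ {p q : Subset n} {x} → q ⊆ p ∪ ⁅ x ⁆ → x ∉ q → q ⊆ p
  q⊆p∪⁅x⁆⇒x∉q⇒q⊆p {p} {x = x} q⊆p∪⁅x⁆ x∉q {y} y∈q with x∈p∪q⁻ p ⁅ x ⁆ (q⊆p∪⁅x⁆ y∈q)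
  ... | inj₁ y∈p   = y∈p
  ... | inj₂ y∈⁅x⁆ = ⊥-elim (x∉q (subst (_∈ _) (x∈⁅y⁆⇒x≡y x y∈⁅x⁆) y∈q))

  ∩≡∅⁻ : ∀ {p q : Subset n} {x} → p ∩ q ≡ ∅ → x ∈ p → x ∉ q
  ∩≡∅⁻ {x = x} p∩q≡∅ x∈p x∈q = ∉⊥ (subst (x ∈_) p∩q≡∅ (x∈p∩q⁺ (x∈p , x∈q)))

  ∩≡∅⁺ : ∀ {p q : Subset n} → (∀ {x} → x ∈ p → x ∉ q) → p ∩ q ≡ ∅
  ∩≡∅⁺ {p} {q} disjoint =
    ⊆-antisym (λ x∈p∩q → let (x∈p , x∈q) = x∈p∩q⁻ p q x∈p∩q in ⊥-elim (disjoint x∈p x∈q))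
              (⊥-elim ∘ ∉⊥)

  x∉p⇒[p∪⁅x⁆]∩q≡∅⇒p∩[q∪⁅x⁆]≡∅ :
    ∀ {p q : Subset n} {x} → x ∉ p → (p ∪ ⁅ x ⁆) ∩ q ≡ ∅ → p ∩ (q ∪ ⁅ x ⁆) ≡ ∅
  x∉p⇒[p∪⁅x⁆]∩q≡∅⇒p∩[q∪⁅x⁆]≡∅ {p} {q} {x} x∉p disjoint = ∩≡∅⁺ avoid
    where
    avoid : ∀ {y} → y ∈ p → y ∉ q ∪ ⁅ x ⁆
    avoid y∈p y∈q∪⁅x⁆ with x∈p∪q⁻ q ⁅ x ⁆ y∈q∪⁅x⁆
    ... | inj₁ y∈q   = ∩≡∅⁻ disjoint (x∈p∪q⁺ (inj₁ y∈p)) y∈q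
    ... | inj₂ y∈⁅x⁆ = x∉p (subst (_∈ p) (x∈⁅y⁆⇒x≡y x y∈⁅x⁆) y∈p)

  ∈-extend⁺ : ∀ (s : Fin n) {Z} L → s ∉ Z → Z ∈ˡ L → Z ∪ ⁅ s ⁆ ∈ˡ extend s L
  ∈-extend⁺ s (S ∷ L) s∉Z Z∈ with s ∈? S | Z∈
  ... | yes s∈S | here refl = ⊥-elim (s∉Z s∈S)
  ... | yes _   | there Z∈L = ∈-extend⁺ s L s∉Z Z∈L
  ... | no  _   | here refl = here refl
  ... | no  _   | there Z∈L = there (∈-extend⁺ s L s∉Z Z∈L)

  ∈-extend⁻ : ∀ (s : Fin n) {X} L → X ∈ˡ extend s L → ∃[ Z ] (Z ∈ˡ L × s ∉ Z × X ≡ Z ∪ ⁅ s ⁆)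
  ∈-extend⁻ s (S ∷ L) X∈ with s ∈? S | X∈
  ... | yes _   | X∈′       = let (Z , Z∈L , s∉Z , X≡) = ∈-extend⁻ s L X∈′ in Z , there Z∈L , s∉Z , X≡
  ... | no  s∉S | here X≡   = S , here refl , s∉S , X≡
  ... | no  _   | there X∈′ = let (Z , Z∈L , s∉Z , X≡) = ∈-extend⁻ s L X∈′ in Z , there Z∈L , s∉Z , X≡

  ++-uniform : ∀ {p} L₁ {L₂ : List (Subset n)} → Uniform p ⟦ L₁ ⟧ → Uniform p ⟦ L₂ ⟧ → Uniform p ⟦ L₁ ++ L₂ ⟧
  ++-uniform L₁ U₁ U₂ X X∈ = [ U₁ X , U₂ X ] (∈-++⁻ L₁ X∈)

Insert : ∀ {n} → Fin n → Family n → Family n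
Insert s F X = ∃[ Z ] (F Z × s ∉ Z × X ≡ Z ∪ ⁅ s ⁆)

module _ {n : ℕ} (k : ℕ) where

  represents-refl : ∀ p (F : Family n) → Represents k p F F
  represents-refl p F = (λ _ FX → FX) , λ X FX _ X∩Y≡∅ _ → X , FX , X∩Y≡∅

  represents-resp : ∀ p {A F G : Family n} → F ≐ G → Represents k p A F → Represents k p A G
  represents-resp p (F⊆G , G⊆F) (A⊆F , complete) = (λ X AX → F⊆G (A⊆F X AX)) , λ X GX → complete X (G⊆F GX)

  represents-trans : ∀ p {A B F : Family n} → Represents k p A B → Represents k p B F → Represents k p A F
  represents-trans p (A⊆B , B→A) (B⊆F , F→B) =
    (λ X AX → B⊆F X (A⊆B X AX)) ,
    λ X FX Y X∩Y≡∅ ∣Y∣≤ → let (Z , BZ , Z∩Y≡∅) = F→B X FX Y X∩Y≡∅ ∣Y∣≤ in B→A Z BZ Y Z∩Y≡∅ ∣Y∣≤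

  represents-uniform : ∀ {p} {A F : Family n} → Represents k p A F → Uniform p F → Uniform p A
  represents-uniform (A⊆F , _) U X AX = U X (A⊆F X AX)

  rep-represents : ∀ {rep} → RepAlgSpec k rep → ∀ {p L} {F : Family n} →
    p ≤ k → Uniform p F → Represents k p ⟦ L ⟧ F → Represents k p ⟦ rep L ⟧ F
  rep-represents spec {p} {L} p≤k U R = represents-trans p (spec p p≤k L (represents-uniform R U)) R

  ++-represents : ∀ {p} L₁ {L₂} {F G : Family n} →
    Represents k p ⟦ L₁ ⟧ F → Represents k p ⟦ L₂ ⟧ G → Represents k p ⟦ L₁ ++ L₂ ⟧ (F ∪ᶠ G)
  ++-represents {p} L₁ {L₂} {F} {G} (L₁⊆F , F→L₁) (L₂⊆G , G→L₂) = sound , complete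
    where
    sound : ∀ X → X ∈ˡ L₁ ++ L₂ → (F ∪ᶠ G) X
    sound X X∈ with ∈-++⁻ L₁ X∈
    ... | inj₁ X∈L₁ = inj₁ (L₁⊆F X X∈L₁)
    ... | inj₂ X∈L₂ = inj₂ (L₂⊆G X X∈L₂)
    complete : ∀ X → (F ∪ᶠ G) X → ∀ Y → X ∩ Y ≡ ∅ → ∣ Y ∣ ≤ k ∸ p →
      ∃[ Xh ] (Xh ∈ˡ L₁ ++ L₂ × Xh ∩ Y ≡ ∅)
    complete X (inj₁ FX) Y X∩Y≡∅ ∣Y∣≤ =
      let (Xh , Xh∈ , Xh∩Y≡∅) = F→L₁ X FX Y X∩Y≡∅ ∣Y∣≤ in Xh , ∈-++⁺ˡ Xh∈ , Xh∩Y≡∅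
    complete X (inj₂ GX) Y X∩Y≡∅ ∣Y∣≤ =
      let (Xh , Xh∈ , Xh∩Y≡∅) = G→L₂ X GX Y X∩Y≡∅ ∣Y∣≤ in Xh , ∈-++⁺ʳ L₁ Xh∈ , Xh∩Y≡∅

  extend-represents : ∀ {p} s L {F : Family n} → p < k →
    Represents k p ⟦ L ⟧ F → Represents k (suc p) ⟦ extend s L ⟧ (Insert s F)
  extend-represents {p} s L {F} p<k (L⊆F , F→L) = sound , complete
    where
    sound : ∀ X → X ∈ˡ extend s L → Insert s F X
    sound X X∈ = let (Z , Z∈L , s∉Z , X≡) = ∈-extend⁻ s L X∈ in Z , L⊆F Z Z∈L , s∉Z , X≡
    complete : ∀ X → Insert s F X → ∀ Y → X ∩ Y ≡ ∅ → ∣ Y ∣ ≤ k ∸ suc p →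
      ∃[ Xh ] (Xh ∈ˡ extend s L × Xh ∩ Y ≡ ∅)
    complete _ (Z , FZ , s∉Z , refl) Y X∩Y≡∅ ∣Y∣≤ =
      add-s (F→L Z FZ (Y ∪ ⁅ s ⁆) (x∉p⇒[p∪⁅x⁆]∩q≡∅⇒p∩[q∪⁅x⁆]≡∅ s∉Z X∩Y≡∅) ∣Y∪⁅s⁆∣≤)
      where
      s∉Y : s ∉ Y
      s∉Y = ∩≡∅⁻ X∩Y≡∅ (x∈p∪q⁺ (inj₂ (x∈⁅x⁆ s)))
      ∣Y∪⁅s⁆∣≤ : ∣ Y ∪ ⁅ s ⁆ ∣ ≤ k ∸ p
      ∣Y∪⁅s⁆∣≤ = subst (_≤ k ∸ p) (sym (x∉p⇒∣p∪⁅x⁆∣≡1+∣p∣ Y s∉Y))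
                       (≤-trans (s≤s ∣Y∣≤) (≤-reflexive (sym (+-∸-assoc 1 p<k))))
      add-s : ∃[ Zh ] (Zh ∈ˡ L × Zh ∩ (Y ∪ ⁅ s ⁆) ≡ ∅) → ∃[ Xh ] (Xh ∈ˡ extend s L × Xh ∩ Y ≡ ∅)
      add-s (Zh , Zh∈L , Zh∩Y∪⁅s⁆≡∅) =
        Zh ∪ ⁅ s ⁆ , ∈-extend⁺ s L s∉Zh Zh∈L ,
        trans (∩-comm (Zh ∪ ⁅ s ⁆) Y)
              (x∉p⇒[p∪⁅x⁆]∩q≡∅⇒p∩[q∪⁅x⁆]≡∅ s∉Y (trans (∩-comm (Y ∪ ⁅ s ⁆) Zh) Zh∩Y∪⁅s⁆≡∅))
        where
        s∉Zh : s ∉ Zh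
        s∉Zh s∈Zh = ∩≡∅⁻ Zh∩Y∪⁅s⁆≡∅ s∈Zh (x∈p∪q⁺ (inj₂ (x∈⁅x⁆ s)))

-- S′ is recorded as X ─ S.
Extensions : ∀ {n} → Family n → Subset n → ℕ → Family n
Extensions B P j X = ∣ X ∣ ≡ j × ∃[ S ] (B S × S ⊆ X × X ─ S ⊆ P)

module _ {n : ℕ} {B : Family n} where

  Extensions-uniform : ∀ {P} j → Uniform j (Extensions B P j)
  Extensions-uniform j _ = proj₁

  Extensions-mono : ∀ {P Q j} → P ⊆ Q → Extensions B P j ⊆ᶠ Extensions B Q j
  Extensions-mono P⊆Q (∣X∣≡j , S , BS , S⊆X , X─S⊆P) = ∣X∣≡j , S , BS , S⊆X , P⊆Q ∘ X─S⊆P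

  Insert-Extensions : ∀ {P s j} → Insert s (Extensions B P j) ⊆ᶠ Extensions B (P ∪ ⁅ s ⁆) (suc j)
  Insert-Extensions {P} {s} (Z , (∣Z∣≡j , S , BS , S⊆Z , Z─S⊆P) , s∉Z , refl) =
    trans (x∉p⇒∣p∪⁅x⁆∣≡1+∣p∣ Z s∉Z) (cong suc ∣Z∣≡j) , S , BS , x∈p∪q⁺ ∘ inj₁ ∘ S⊆Z , X─S⊆P∪⁅s⁆
    where
    X─S⊆P∪⁅s⁆ : (Z ∪ ⁅ s ⁆) ─ S ⊆ P ∪ ⁅ s ⁆
    X─S⊆P∪⁅s⁆ x∈X─S with x∈p∪q⁻ Z ⁅ s ⁆ (p─q⊆p _ S x∈X─S)
    ... | inj₁ x∈Z   = x∈p∪q⁺ (inj₁ (Z─S⊆P (x∈p∧x∉q⇒x∈p─q x∈Z (x∈p─q⇒x∉q _ S x∈X─S))))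
    ... | inj₂ x∈⁅s⁆ = x∈p∪q⁺ (inj₂ x∈⁅s⁆)

  Extensions-split : ∀ {P s j} → Extensions B (P ∪ ⁅ s ⁆) j ⊆ᶠ
    Extensions B P j ∪ᶠ Insert s (Extensions B P (j ∸ 1))
  Extensions-split {P} {s} {j} {X} (∣X∣≡j , S , BS , S⊆X , X─S⊆P∪⁅s⁆) with s ∈? X ─ S
  ... | no s∉X─S = inj₁ (∣X∣≡j , S , BS , S⊆X , q⊆p∪⁅x⁆⇒x∉q⇒q⊆p X─S⊆P∪⁅s⁆ s∉X─S)
  ... | yes s∈X─S = inj₂ (X - s , (∣X-s∣≡j∸1 , S , BS , S⊆X-s , X-s─S⊆P) , x∉p-x X s , X≡)
    where
    X≡ : X ≡ (X - s) ∪ ⁅ s ⁆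
    X≡ = x∈p⇒p≡[p-x]∪⁅x⁆ (p─q⊆p X S s∈X─S)
    ∣X-s∣≡j∸1 : ∣ X - s ∣ ≡ j ∸ 1
    ∣X-s∣≡j∸1 = cong (_∸ 1) (trans (sym (x∉p⇒∣p∪⁅x⁆∣≡1+∣p∣ (X - s) (x∉p-x X s)))
                                    (trans (cong ∣_∣ (sym X≡)) ∣X∣≡j))
    S⊆X-s : S ⊆ X - s
    S⊆X-s x∈S = x∈p∧x≢y⇒x∈p-y (S⊆X x∈S) λ { refl → x∈p─q⇒x∉q X S s∈X─S x∈S }
    X-s─S⊆P : X - s ─ S ⊆ P
    X-s─S⊆P = subst (_⊆ P) (sym (p─q─r≡p─r─q X ⁅ s ⁆ S))
      (q⊆p∪⁅x⁆⇒x∉q⇒q⊆p (X─S⊆P∪⁅s⁆ ∘ p─q⊆p (X ─ S) ⁅ s ⁆) (x∉p-x (X ─ S) s))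

  Extensions-∪⁅⁆-zero : ∀ {P s} → Extensions B P 0 ≐ Extensions B (P ∪ ⁅ s ⁆) 0
  Extensions-∪⁅⁆-zero {P} {s} = Extensions-mono (p⊆p∪q ⁅ s ⁆) , shrink
    where
    shrink : Extensions B (P ∪ ⁅ s ⁆) 0 ⊆ᶠ Extensions B P 0
    shrink E with Extensions-split E
    ... | inj₁ E′ = E′
    ... | inj₂ I = ⊥-elim (0≢1+n (trans (sym (proj₁ E)) (proj₁ (Insert-Extensions I))))

  Extensions-∪⁅⁆-suc : ∀ {P s j} →
    Extensions B P (suc j) ∪ᶠ Insert s (Extensions B P j) ≐ Extensions B (P ∪ ⁅ s ⁆) (suc j)
  Extensions-∪⁅⁆-suc {s = s} =
    [ Extensions-mono (p⊆p∪q ⁅ s ⁆) , Insert-Extensions ] , Extensions-split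

⟦⟧≐Extensions-∅ : ∀ {n} {B : ℕ → List (Subset n)} {j} → Uniform j ⟦ B j ⟧ →
  ⟦ B j ⟧ ≐ Extensions (λ S → S ∈ˡ B ∣ S ∣) ∅ j
⟦⟧≐Extensions-∅ {B = B} {j} U = to , from
  where
  to : ⟦ B j ⟧ ⊆ᶠ Extensions (λ S → S ∈ˡ B ∣ S ∣) ∅ j
  to {X} X∈ = U X X∈ , X , subst (λ i → X ∈ˡ B i) (sym (U X X∈)) X∈ , ⊆-refl ,
              λ x∈X─X → ⊥-elim (x∈p─q⇒x∉q X X x∈X─X (p─q⊆p X X x∈X─X))
  from : Extensions (λ S → S ∈ˡ B ∣ S ∣) ∅ j ⊆ᶠ ⟦ B j ⟧
  from {X} (∣X∣≡j , S , S∈ , S⊆X , X─S⊆∅) with ⊆-antisym S⊆X (subst (X ⊆_) (∪-identityʳ S) (q─p⊆r⇒q⊆p∪r X─S⊆∅))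
  ... | refl = subst (λ i → S ∈ˡ B i) ∣X∣≡j S∈

module Correctness {n : ℕ} (k : ℕ) (𝒮 : List (List (Fin n)))
                   (rep : List (Subset n) → List (Subset n)) (spec : RepAlgSpec k rep) where
  open PCAlg k 𝒮 rep

  Invariant : Family n → Subset n → (ℕ → List (Subset n)) → Set
  Invariant B P A = ∀ j → j ≤ k → Represents k j ⟦ A j ⟧ (Extensions B P j)

  step-invariant : ∀ {B P A} s → Invariant B P A → Invariant B (P ∪ ⁅ s ⁆) (step s A)
  step-invariant s I zero 0≤k =
    rep-represents k spec 0≤k (Extensions-uniform 0)
      (represents-resp k 0 Extensions-∪⁅⁆-zero (I 0 0≤k))
  step-invariant {A = A} s I (suc j) j<k =
    rep-represents k spec j<k (Extensions-uniform (suc j))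
      (represents-resp k (suc j) Extensions-∪⁅⁆-suc
        (++-represents k {suc j} (A (suc j)) (I (suc j) j<k) (extend-represents k s (A j) j<k (I j (<⇒≤ j<k)))))

  steps-invariant : ∀ {B P A} ss → Invariant B P A → Invariant B (P ∪ toSubset ss) (steps ss A)
  steps-invariant {B} {P} {A} [] I = subst (λ Q → Invariant B Q A) (sym (∪-identityʳ P)) I
  steps-invariant {B} {P} {A} (s ∷ ss) I =
    subst (λ Q → Invariant B Q (steps ss (step s A))) (∪-assoc P ⁅ s ⁆ (toSubset ss))
      (steps-invariant ss (step-invariant s I))

  initial-invariant : ∀ {B} → (∀ j → Uniform j ⟦ B j ⟧) → Invariant (λ S → S ∈ˡ B ∣ S ∣) ∅ B
  initial-invariant {B} U j _ = represents-resp k j (⟦⟧≐Extensions-∅ (U j)) (represents-refl k j ⟦ B j ⟧)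

  A₀-uniform : ∀ {Mp} ℓ → (∀ j ℓ′ → Uniform j ⟦ Mp j ℓ′ ⟧) → ∀ j → Uniform j ⟦ A₀ Mp ℓ j ⟧
  A₀-uniform ℓ U zero    _ (here refl) = ∣⊥∣≡0 n
  A₀-uniform ℓ U (suc j) = U (suc j) (ℓ ∸ 1)

  Base : ℕ → ℕ → Family n
  Base i ℓ S = S ∈ˡ A₀ (M (i ∸ 1)) ℓ ∣ S ∣

  A-invariant : ∀ i ℓ → (∀ j ℓ′ → Uniform j ⟦ M (i ∸ 1) j ℓ′ ⟧) →
    Invariant (Base i ℓ) (toSubset (nth 𝒮 i)) (A i ℓ)
  A-invariant i ℓ U =
    subst (λ P → Invariant (Base i ℓ) P (A i ℓ)) (∪-identityˡ (toSubset (nth 𝒮 i)))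
      (steps-invariant (nth 𝒮 i) (initial-invariant (A₀-uniform ℓ U)))

  M-uniform : ∀ i j ℓ → Uniform j ⟦ M i j ℓ ⟧
  M-uniform zero    j ℓ _ ()
  M-uniform (suc i) j ℓ with inLoop? (suc i) j ℓ
  ... | no  _ = λ _ ()
  ... | yes ((_ , j≤k) , _) = represents-uniform k (spec j j≤k L U) U
    where
    L : List (Subset n)
    L = M i j ℓ ++ A (suc i) ℓ j
    U : Uniform j ⟦ L ⟧
    U = ++-uniform (M i j ℓ) (M-uniform i j ℓ)
          (represents-uniform k (A-invariant (suc i) ℓ (M-uniform i) j j≤k) (Extensions-uniform j))

  ∈A₀⁻ : ∀ {Mp ℓ S j} j′ → S ∈ˡ A₀ Mp ℓ j′ → j′ ≤ j →
    S ≡ ∅ ⊎ ∃[ j″ ] ((1 ≤ j″ × j″ ≤ j) × S ∈ˡ Mp j″ (ℓ ∸ 1))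
  ∈A₀⁻ zero     (here S≡∅) _    = inj₁ S≡∅
  ∈A₀⁻ (suc j′) S∈ j′≤j = inj₂ (suc j′ , (s≤s z≤n , j′≤j) , S∈)

  ∈A₀⁺ : ∀ {Mp ℓ S j} → (∀ j ℓ′ → Uniform j ⟦ Mp j ℓ′ ⟧) →
    S ≡ ∅ ⊎ ∃[ j″ ] ((1 ≤ j″ × j″ ≤ j) × S ∈ˡ Mp j″ (ℓ ∸ 1)) → S ∈ˡ A₀ Mp ℓ ∣ S ∣
  ∈A₀⁺ {Mp} {ℓ} U (inj₁ refl) = subst (λ j → ∅ ∈ˡ A₀ Mp ℓ j) (sym (∣⊥∣≡0 n)) (here refl)
  ∈A₀⁺ {Mp} {ℓ} {S} U (inj₂ (suc j″ , _ , S∈)) =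
    subst (λ j → S ∈ˡ A₀ Mp ℓ j) (sym (U (suc j″) (ℓ ∸ 1) S S∈)) S∈

  Extensions≐AStar : ∀ i j ℓ → (∀ j ℓ′ → Uniform j ⟦ M (i ∸ 1) j ℓ′ ⟧) →
    Extensions (Base i ℓ) (toSubset (nth 𝒮 i)) j ≐ AStar i j ℓ
  Extensions≐AStar i j ℓ U = to , from
    where
    to : Extensions (Base i ℓ) (toSubset (nth 𝒮 i)) j ⊆ᶠ AStar i j ℓ
    to {X} (∣X∣≡j , S , S∈ , S⊆X , X─S⊆T) =
      S , X ─ S , ∈A₀⁻ ∣ S ∣ S∈ (≤-trans (p⊆q⇒∣p∣≤∣q∣ S⊆X) (≤-reflexive ∣X∣≡j)) ,
      X─S⊆T , p⊆q⇒q≡p∪[q─p] S⊆X , ∣X∣≡j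
    from : AStar i j ℓ ⊆ᶠ Extensions (Base i ℓ) (toSubset (nth 𝒮 i)) j
    from (S , S′ , S-base , S′⊆T , refl , ∣X∣≡j) =
      ∣X∣≡j , S , ∈A₀⁺ U S-base , p⊆p∪q S′ , S′⊆T ∘ p∪q─p⊆q S S′

lemma1 : (n k : ℕ) (𝒮 : List (List (Fin n))) →
    All Unique 𝒮 →
    All (λ S → length S < k) 𝒮 →
    (rep : List (Subset n) → List (Subset n)) → RepAlgSpec k rep →
    (i j ℓ : ℕ) → 1 ≤ i → i ≤ length 𝒮 → 1 ≤ j → j ≤ k → 1 ≤ ℓ → ℓ ≤ i ⊓ k →
    Represents k j ⟦ PCAlg.A k 𝒮 rep i ℓ j ⟧ (PCAlg.AStar k 𝒮 rep i j ℓ)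
lemma1 n k 𝒮 _ _ rep spec i j ℓ _ _ _ j≤k _ _ =
  represents-resp k j (Extensions≐AStar i j ℓ U) (A-invariant i ℓ U j j≤k)
  where
  open Correctness k 𝒮 rep spec
  U : ∀ j ℓ′ → Uniform j ⟦ PCAlg.M k 𝒮 rep (i ∸ 1) j ℓ′ ⟧
  U = M-uniform (i ∸ 1)
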